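{- Boudol's encoding $\mathcal T_{\rm B}$ is not valid up to weak $o\tau$-bisimilarity $\approx_{o\tau}$, and hence not up to weak asynchronous bisimilarity $\approx_{\mathrm{WAB}}$: there is a process $P$ of $\pi$ with $\mathcal T_{\rm B}(P)\not\approx_{o\tau}P$ and $\mathcal T_{\rm B}(P)\not\approx_{\mathrm{WAB}}P$.
   Context: Fix an infinite set $\mathcal N$ of names. Processes of $\pi$: $P ::= \mathbf{0} \mid \bar x z.P \mid x(y).P \mid P|Q \mid (y)P \mid\ !P$; $\mathrm{fn}(P)$, $\mathrm n(P)$ free/all names; $P\{w/y\}$ capture-avoiding substitution. $\mathcal T_{\rm B}$: homomorphic on $\mathbf 0,|,!$, restriction; $\mathcal T_{\rm B}(\bar xz.P)=(u)(\bar xu|u(v).(\bar vz|\mathcal T_{\rm B}(P)))$, $u,v\notin\mathrm{fn}(P)\cup\{x,z\}$; $\mathcal T_{\rm B}(x(y).P)=x(u).(v)(\bar uv|v(y).\mathcal T_{\rm B}(P))$, $u,v\notin\mathrm{fn}(P)\cup\{x\}$; $u\ne v$. Labels: $\bar xy$, $x(y)$, $\bar x(y)$, $\tau$, with $\mathrm{bn}(x(y))=\mathrm{bn}(\bar x(y))=\{y\}$, otherwise $\mathrm{bn}=\emptyset$; $\mathrm{fn}(\bar xz)=\{x,z\}$, $\mathrm{fn}(x(y))=\mathrm{fn}(\bar x(y))=\{x\}$, $\mathrm{fn}(\tau)=\emptyset$; $\mathrm n(\alpha)=\mathrm{fn}(\alpha)\cup\mathrm{bn}(\alpha)$. The transition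 relation is the least one with: $\bar xz.P\xrightarrow{\bar xz}P$; $x(y).P\xrightarrow{x(w)}P\{w/y\}$ if $w\notin\mathrm{fn}((y)P)$; $P\xrightarrow{\alpha}P'$, $\mathrm{bn}(\alpha)\cap\mathrm{fn}(Q)=\emptyset$ $\Rightarrow$ $P|Q\xrightarrow\alpha P'|Q$; $P\xrightarrow{\bar xz}P'$, $Q\xrightarrow{x(y)}Q'$ $\Rightarrow$ $P|Q\xrightarrow\tau P'|Q'\{z/y\}$; $P\xrightarrow{\bar x(w)}P'$, $Q\xrightarrow{x(w)}Q'$ $\Rightarrow$ $P|Q\xrightarrow\tau(w)(P'|Q')$ (the last three also symmetrically); $P\xrightarrow\alpha P'$, $y\notin\mathrm n(\alpha)$ $\Rightarrow$ $(y)P\xrightarrow\alpha(y)P'$; $P\xrightarrow{\bar xy}P'$, $y\neq x$, $w\notin\mathrm{fn}((y)P')$ $\Rightarrow$ $(y)P\xrightarrow{\bar x(w)}P'\{w/y\}$; $P\xrightarrow\alpha P'$ $\Rightarrow$ $!P\xrightarrow\alpha P'|!P$; $P\xrightarrow{\bar xz}P'$, $P\xrightarrow{x(y)}P''$ $\Rightarrow$ $!P\xrightarrow\tau(P'|P''\{z/y\})|!P$; $P\xrightarrow{\bar x(w)}P'$, $P\xrightarrow{x(w)}P''$ $\Rightarrow$ $!P\xrightarrow\tau((w)(P'|P''))|!P$. Write $\Rightarrow$ for $(\xrightarrow\tau)^*$. A symmetric relation $S$ is a weak $o\tau$-bisimulation if $P\,S\,Q$ implies: (1) if $P\xrightarrow\tau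 P'$ then $Q\Rightarrow Q'$ with $P'\,S\,Q'$; (2) if $P\xrightarrow\alpha P'$ with $\alpha=\bar xz$ or $\alpha=\bar x(y)$, $y\notin\mathrm n(P)\cup\mathrm n(Q)$, then $Q\Rightarrow\xrightarrow\alpha\Rightarrow Q'$ with $P'\,S\,Q'$. $\approx_{o\tau}$ is the largest one. A weak asynchronous bisimulation is a weak $o\tau$-bisimulation $S$ such that whenever $P\,S\,Q$ and $P\Rightarrow\xrightarrow{x(y)}\Rightarrow P'$ (with $y$ fresh), either for all $w$ there is $Q'$ with $Q\Rightarrow\xrightarrow{x(y)}\Rightarrow Q'$ and $P'\{w/y\}\,S\,Q'\{w/y\}$, or there is $Q'$ with $Q\Rightarrow Q'$ and $P'\,S\,(Q'|\bar xy)$. $\approx_{\mathrm{WAB}}$ is the largest weak asynchronous bisimulation. -}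

module Defs where

open import Data.Nat using (ℕ; suc; _⊔_)
open import Data.Nat.Properties using (_≟_)
open import Data.Bool using (if_then_else_)
open import Data.List using (List; []; _∷_; _++_; filter; map; foldr)
open import Data.List.Membership.Propositional using (_∈_; _∉_)
open import Data.List.Membership.DecPropositional _≟_ using (_∈?_)
open import Data.Product using (Σ; _×_; ∃)
open import Data.Sum using (_⊎_)
open import Relation.Nullary using (¬_; ¬?; does)
open import Relation.Binary.PropositionalEquality using (_≡_; _≢_)
open import Relation.Binary.Construct.Closure.ReflexiveTransitive using (Star)

Name : Set
Name = ℕ

-- Processes of π (named syntax, no quotient by α-conversion)

infixr 6 _∣_
data Proc : Set where
  𝟎   : Proc
  out : Name → Name → Proc → Proc
  inp : Name → Name → Proc → Proc   -- x(y).P   (y bound in P)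
  _∣_ : Proc → Proc → Proc
  ν   : Name → Proc → Proc          -- (y)P     (y bound in P)
  !_  : Proc → Proc

remove : Name → List Name → List Name
remove y = filter (λ n → ¬? (n ≟ y))

fn : Proc → List Name
fn 𝟎           = []
fn (out x z P) = x ∷ z ∷ fn P
fn (inp x y P) = x ∷ remove y (fn P)
fn (P ∣ Q)     = fn P ++ fn Q
fn (ν y P)     = remove y (fn P)
fn (! P)       = fn P

names : Proc → List Name
names 𝟎           = []
names (out x z P) = x ∷ z ∷ names P
names (inp x y P) = x ∷ y ∷ names P
names (P ∣ Q)     = names P ++ names Q
names (ν y P)     = y ∷ names P
names (! P)       = names P

fresh : List Name → Name
fresh l = suc (foldr _⊔_ 0 l)

update : (Name → Name) → Name → Name → (Name → Name)
update σ y w n = if does (n ≟ y) then w else σ n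

-- new name for a binder y over body P under σ: keep y unless it would
-- capture the image of a free name of (y)P, otherwise pick a fresh one
rebind : (Name → Name) → Name → Proc → Name
rebind σ y P =
  let img = map σ (remove y (fn P)) in
  if does (y ∈? img) then fresh img else y

sub : (Name → Name) → Proc → Proc
sub σ 𝟎           = 𝟎
sub σ (out x z P) = out (σ x) (σ z) (sub σ P)
sub σ (inp x y P) = inp (σ x) (rebind σ y P) (sub (update σ y (rebind σ y P)) P)
sub σ (P ∣ Q)     = sub σ P ∣ sub σ Q
sub σ (ν y P)     = ν (rebind σ y P) (sub (update σ y (rebind σ y P)) P)
sub σ (! P)       = ! sub σ P

_[_/_] : Proc → Name → Name → Proc
P [ w / y ] = sub (update (λ n → n) y w) P

data Label : Set where
  outL  : Name → Name → Label
  inpL  : Name → Name → Label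
  boutL : Name → Name → Label
  τ     : Label

bn : Label → List Name
bn (outL x z)  = []
bn (inpL x y)  = y ∷ []
bn (boutL x y) = y ∷ []
bn τ           = []

fnL : Label → List Name
fnL (outL x z)  = x ∷ z ∷ []
fnL (inpL x y)  = x ∷ []
fnL (boutL x y) = x ∷ []
fnL τ           = []

nL : Label → List Name
nL α = fnL α ++ bn α

infix 4 _—[_]→_
data _—[_]→_ : Proc → Label → Proc → Set where
  outP   : ∀ {x z P} → out x z P —[ outL x z ]→ P
  inpP   : ∀ {x y w P} → w ∉ fn (ν y P) → inp x y P —[ inpL x w ]→ P [ w / y ]
  parL   : ∀ {P P' Q α} → P —[ α ]→ P' → (∀ n → n ∈ bn α → n ∉ fn Q) →
           P ∣ Q —[ α ]→ P' ∣ Q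
  parR   : ∀ {P P' Q α} → P —[ α ]→ P' → (∀ n → n ∈ bn α → n ∉ fn Q) →
           Q ∣ P —[ α ]→ Q ∣ P'
  commL  : ∀ {P P' Q Q' x y z} → P —[ outL x z ]→ P' → Q —[ inpL x y ]→ Q' →
           P ∣ Q —[ τ ]→ P' ∣ (Q' [ z / y ])
  commR  : ∀ {P P' Q Q' x y z} → P —[ outL x z ]→ P' → Q —[ inpL x y ]→ Q' →
           Q ∣ P —[ τ ]→ (Q' [ z / y ]) ∣ P'
  closeL : ∀ {P P' Q Q' x w} → P —[ boutL x w ]→ P' → Q —[ inpL x w ]→ Q' →
           P ∣ Q —[ τ ]→ ν w (P' ∣ Q')
  closeR : ∀ {P P' Q Q' x w} → P —[ boutL x w ]→ P' → Q —[ inpL x w ]→ Q' →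
           Q ∣ P —[ τ ]→ ν w (Q' ∣ P')
  res    : ∀ {P P' y α} → P —[ α ]→ P' → y ∉ nL α → ν y P —[ α ]→ ν y P'
  open′  : ∀ {P P' x y w} → P —[ outL x y ]→ P' → y ≢ x → w ∉ fn (ν y P') →
           ν y P —[ boutL x w ]→ P' [ w / y ]
  rep    : ∀ {P P' α} → P —[ α ]→ P' → ! P —[ α ]→ P' ∣ ! P
  repComm  : ∀ {P P' P'' x y z} → P —[ outL x z ]→ P' → P —[ inpL x y ]→ P'' →
             ! P —[ τ ]→ (P' ∣ (P'' [ z / y ])) ∣ ! P
  repClose : ∀ {P P' P'' x w} → P —[ boutL x w ]→ P' → P —[ inpL x w ]→ P'' →
             ! P —[ τ ]→ ν w (P' ∣ P'') ∣ ! P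

infix 4 _⇒_
_⇒_ : Proc → Proc → Set
_⇒_ = Star (λ P Q → P —[ τ ]→ Q)

infix 4 _⇒[_]⇒_
_⇒[_]⇒_ : Proc → Label → Proc → Set
P ⇒[ α ]⇒ Q = Σ Proc λ P₁ → Σ Proc λ P₂ → (P ⇒ P₁) × (P₁ —[ α ]→ P₂) × (P₂ ⇒ Q)

Rel : Set₁
Rel = Proc → Proc → Set

record IsWeakOτBisim (S : Rel) : Set where
  field
    sym   : ∀ {P Q} → S P Q → S Q P
    tauC  : ∀ {P Q P'} → S P Q → P —[ τ ]→ P' →
            Σ Proc λ Q' → (Q ⇒ Q') × S P' Q'
    outC  : ∀ {P Q P' x z} → S P Q → P —[ outL x z ]→ P' →
            Σ Proc λ Q' → (Q ⇒[ outL x z ]⇒ Q') × S P' Q'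
    boutC : ∀ {P Q P' x y} → S P Q → y ∉ names P → y ∉ names Q →
            P —[ boutL x y ]→ P' →
            Σ Proc λ Q' → (Q ⇒[ boutL x y ]⇒ Q') × S P' Q'

infix 4 _≈oτ_ _≈WAB_
_≈oτ_ : Proc → Proc → Set₁
P ≈oτ Q = Σ Rel λ S → IsWeakOτBisim S × S P Q

record IsWAB (S : Rel) : Set where
  field
    isOτ  : IsWeakOτBisim S
    async : ∀ {P Q P' x y} → S P Q → y ∉ names P → y ∉ names Q →
            P ⇒[ inpL x y ]⇒ P' →
            (∀ w → Σ Proc λ Q' → (Q ⇒[ inpL x y ]⇒ Q') × S (P' [ w / y ]) (Q' [ w / y ]))
            ⊎ (Σ Proc λ Q' → (Q ⇒ Q') × S P' (Q' ∣ out x y 𝟎))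

_≈WAB_ : Proc → Proc → Set₁
P ≈WAB Q = Σ Rel λ S → IsWAB S × S P Q

-- Boudol's encoding 𝒯_B, as a relation  TB P Q  ("Q is 𝒯_B(P) for some
-- admissible choice of the auxiliary names u, v")

data TB : Proc → Proc → Set where
  tb𝟎   : TB 𝟎 𝟎
  tbPar : ∀ {P P' Q Q'} → TB P P' → TB Q Q' → TB (P ∣ Q) (P' ∣ Q')
  tbRep : ∀ {P P'} → TB P P' → TB (! P) (! P')
  tbRes : ∀ {y P P'} → TB P P' → TB (ν y P) (ν y P')
  tbOut : ∀ {x z u v P P'} → TB P P' →
          u ∉ x ∷ z ∷ fn P → v ∉ x ∷ z ∷ fn P → u ≢ v →
          TB (out x z P) (ν u (out x u 𝟎 ∣ inp u v (out v z 𝟎 ∣ P')))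
  tbInp : ∀ {x y u v P P'} → TB P P' →
          u ∉ x ∷ fn P → v ∉ x ∷ fn P → u ≢ v →
          TB (inp x y P) (inp x u (ν v (out u v 𝟎 ∣ inp v y P')))

-- Boudol's encoding of x̄z.P is (u)(x̄u | u(v).(v̄z | 𝒯_B(P))) with u fresh. Its only
-- output, x̄u, carries the restricted name u and so escapes only as a bound output,
-- and no communication is possible since u ≠ x. Thus the encoding can perform
-- neither a τ-step nor a free output, and cannot weakly match the free output x̄z of
-- x̄z.P. Every weak asynchronous bisimulation is a weak oτ-bisimulation, so the
-- same process separates the encoding from its source under ≈WAB.
module Submission where

open import Defs
open import Data.List using (_∷_; foldr)
open import Data.List.Membership.Propositional using (_∈_; _∉_)
open import Data.List.Relation.Unary.Any using (here; there)
open import Data.Nat using (_≤_; _⊔_)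
open import Data.Nat.Properties using (≤-trans; m≤m⊔n; m≤n⊔m; 1+n≰n)
open import Data.Product using (Σ; _×_; _,_)
open import Relation.Nullary using (¬_)
open import Relation.Binary.PropositionalEquality using (refl; _≢_; sym)
open import Relation.Binary.Construct.Closure.ReflexiveTransitive using (ε; _◅_)

∈⇒≤max : ∀ {n : Name} {l} → n ∈ l → n ≤ foldr _⊔_ 0 l
∈⇒≤max {l = m ∷ l} (here refl) = m≤m⊔n m (foldr _⊔_ 0 l)
∈⇒≤max {l = m ∷ l} (there n∈l) = ≤-trans (∈⇒≤max n∈l) (m≤n⊔m m (foldr _⊔_ 0 l))

fresh-∉ : ∀ l → fresh l ∉ l
fresh-∉ l fresh∈l = 1+n≰n (∈⇒≤max fresh∈l)

distinct-fresh-pair : ∀ l → Σ Name λ u → Σ Name λ v → u ∉ l × v ∉ l × u ≢ v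
distinct-fresh-pair l = u , v , fresh-∉ l , v∉l , u≢v
  where
  u = fresh l
  v = fresh (u ∷ l)
  v∉l : v ∉ l
  v∉l v∈l = fresh-∉ (u ∷ l) (there v∈l)
  u≢v : u ≢ v
  u≢v u≡v = fresh-∉ (u ∷ l) (here (sym u≡v))

TB-total : ∀ P → Σ Proc (TB P)
TB-total 𝟎 = 𝟎 , tb𝟎
TB-total (out x z P) with TB-total P | distinct-fresh-pair (x ∷ z ∷ fn P)
... | _ , tbP | _ , _ , u∉ , v∉ , u≢v = _ , tbOut tbP u∉ v∉ u≢v
TB-total (inp x y P) with TB-total P | distinct-fresh-pair (x ∷ fn P)
... | _ , tbP | _ , _ , u∉ , v∉ , u≢v = _ , tbInp tbP u∉ v∉ u≢v
TB-total (P ∣ Q) with TB-total P | TB-total Q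
... | _ , tbP | _ , tbQ = _ , tbPar tbP tbQ
TB-total (ν y P) with TB-total P
... | _ , tbP = _ , tbRes tbP
TB-total (! P) with TB-total P
... | _ , tbP = _ , tbRep tbP

module _ {x u v : Name} {R : Proc} where

  encodedOutput-no-τ : u ≢ x → ∀ {T} → ¬ (ν u (out x u 𝟎 ∣ inp u v R) —[ τ ]→ T)
  encodedOutput-no-τ u≢x (res (parL () _) _)
  encodedOutput-no-τ u≢x (res (parR () _) _)
  encodedOutput-no-τ u≢x (res (commL outP (inpP _)) _) = u≢x refl
  encodedOutput-no-τ u≢x (res (commR () _) _)
  encodedOutput-no-τ u≢x (res (closeL () _) _)
  encodedOutput-no-τ u≢x (res (closeR () _) _)

  encodedOutput-no-free-output : ∀ {a b T} → ¬ (ν u (out x u 𝟎 ∣ inp u v R) —[ outL a b ]→ T)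
  encodedOutput-no-free-output (res (parL outP _) u∉α) = u∉α (there (here refl))
  encodedOutput-no-free-output (res (parR () _) _)

  encodedOutput-no-weak-free-output :
    u ≢ x → ∀ {a b T} → ¬ (ν u (out x u 𝟎 ∣ inp u v R) ⇒[ outL a b ]⇒ T)
  encodedOutput-no-weak-free-output _ (_ , _ , ε , step , _) = encodedOutput-no-free-output step
  encodedOutput-no-weak-free-output u≢x (_ , _ , t ◅ _ , _ , _) = encodedOutput-no-τ u≢x t

output-≉-encoding : ∀ {S x z P Q} → IsWeakOτBisim S → TB (out x z P) Q → ¬ S (out x z P) Q
output-≉-encoding bisim (tbOut _ u∉ _ _) related
  with IsWeakOτBisim.outC bisim related outP
... | _ , weakOutput , _ = encodedOutput-no-weak-free-output (λ u≡x → u∉ (here u≡x)) weakOutput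

encoding-≉oτ-output : ∀ {x z P Q} → TB (out x z P) Q → ¬ (Q ≈oτ out x z P)
encoding-≉oτ-output tb (S , bisim , related) =
  output-≉-encoding bisim tb (IsWeakOτBisim.sym bisim related)

≈WAB⇒≈oτ : ∀ {P Q} → P ≈WAB Q → P ≈oτ Q
≈WAB⇒≈oτ (S , wab , related) = S , IsWAB.isOτ wab , related

mainTheorem9 : Σ Proc λ P → (Σ Proc λ Q → TB P Q) × (∀ Q → TB P Q → ¬ (Q ≈oτ P) × ¬ (Q ≈WAB P))
mainTheorem9 = out 0 1 𝟎 , TB-total _ , λ Q tb →
  encoding-≉oτ-output tb , λ Q≈P → encoding-≉oτ-output tb (≈WAB⇒≈oτ Q≈P)
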